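{- Let $m\geq 3$ be an odd integer and let $\alpha$ be a root of $x^2-mx-2$. Then $\alpha\sim\alpha/2\sim(\alpha+1)/2$.
   Context: Two real irrationals $\alpha,\beta$ are equivalent, written $\alpha\sim\beta$, if there exist integers $a,b,c,d$ with $ad-bc=\pm1$ such that $\beta=\frac{a\alpha+b}{c\alpha+d}$. -}

module Defs where

open import Data.Nat as ℕ using (ℕ)
open import Data.Integer as ℤ using (ℤ; +_)
open import Data.Rational as ℚ using (ℚ; _/_)
open import Data.Product using (∃-syntax; _×_)
open import Data.Sum using (_⊎_)
open import Relation.Binary.PropositionalEquality using (_≡_)

-- Elements x + y√D of the quadratic field ℚ(√D) (D a non-square natural number),
-- viewed as real numbers via the positive square root √D.
record Quad (D : ℕ) : Set where
  constructor _+_√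
  field
    re : ℚ
    im : ℚ
open Quad public

module _ {D : ℕ} where
  infixl 6 _⊕_
  infixl 7 _⊗_

  _⊕_ : Quad D → Quad D → Quad D
  (a + b √) ⊕ (c + d √) = (a ℚ.+ c) + (b ℚ.+ d) √

  _⊗_ : Quad D → Quad D → Quad D
  (a + b √) ⊗ (c + d √) =
    (a ℚ.* c ℚ.+ ((+ D) / 1) ℚ.* (b ℚ.* d)) + (a ℚ.* d ℚ.+ b ℚ.* c) √

  ι : ℚ → Quad D
  ι q = q + ℚ.0ℚ √

  ιℤ : ℤ → Quad D
  ιℤ z = ι (z / 1)

  -- Equivalence of irrationals: β = (aα+b)/(cα+d) with ad − bc = ±1.
  -- Since α is irrational and (c,d) ≠ (0,0), cα+d ≠ 0, so the equation is
  -- equivalent to β·(cα+d) = aα+b.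
  _∼_ : Quad D → Quad D → Set
  α ∼ β = ∃[ a ] ∃[ b ] ∃[ c ] ∃[ d ]
            ((a ℤ.* d ℤ.- b ℤ.* c ≡ ℤ.+ 1 ⊎ a ℤ.* d ℤ.- b ℤ.* c ≡ ℤ.- ℤ.+ 1)
            × β ⊗ (ιℤ c ⊗ α ⊕ ιℤ d) ≡ ιℤ a ⊗ α ⊕ ιℤ b)

-- Write h for ½. Since α(α − m) = 2, we get α/2 = 1/(α − m), a Möbius
-- transformation of determinant −1. For m = 2k + 1, multiplying out with α² = mα + 2
-- and 2h = 1 shows (α + 1)/2 = (((k + 1)m + 1)·(α/2) + (k + 1)) / (m·(α/2) + 1), of
-- determinant 1. Both identities hold in any commutative ring containing ½ and a root
-- of x² − mx − 2, so they are proved there and then applied in ℚ(√(m² + 8)).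
module Submission where

open import Defs
open import Data.Nat using (ℕ)
open import Data.Integer using (+_)
open import Data.Rational using (_/_)
open import Data.Product using (_×_)
open import Relation.Binary.PropositionalEquality using (_≡_)

open import Algebra.Bundles using (CommutativeRing)
open import Algebra.Structures using (IsCommutativeRing)
import Algebra.Consequences.Propositional as Consequences
import Algebra.Definitions as AlgebraDefinitions
import Algebra.Properties.Ring as RingProperties
import Algebra.Solver.Ring.NaturalCoefficients.Default as NaturalCoefficientsSolver
import Data.Integer as ℤ
import Data.Integer.Properties as ℤP
open import Data.Integer.Tactic.RingSolver using (solve-∀)
open import Data.Product using (_,_)
open import Data.Rational as ℚ using (0ℚ; 1ℚ; ½; fromℚᵘ; toℚᵘ)
import Data.Rational.Properties as ℚP
import Data.Rational.Unnormalised as ℚᵘ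
import Data.Rational.Unnormalised.Properties as ℚᵘP
open import Data.Sum using (inj₁; inj₂)
open import Level using (0ℓ)
import Relation.Binary.PropositionalEquality as ≡

module MöbiusIdentities {c ℓ} (R : CommutativeRing c ℓ) where
  open CommutativeRing R
  open RingProperties ring using (+-cancelʳ)
  open NaturalCoefficientsSolver commutativeSemiring using (solve; _:=_; _:+_; _:*_; con)

  -- Turns an identity modulo relations t ≈ s into the subtraction-free
  -- l + s ≈ r + t, which the natural-coefficient solver can check.
  ≈-by-certificate : ∀ {l r s t} → l + s ≈ r + t → t ≈ s → l ≈ r
  ≈-by-certificate {l} {r} {s} l+s≈r+t t≈s = +-cancelʳ s l r (trans l+s≈r+t (+-congˡ t≈s))

  -- lhs − rhs = h·(x² − mx − 2) + (2h − 1) + hx·(m + d)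
  half-root-reciprocal : ∀ {x m d h} →
    x * x ≈ m * x + (1# + 1#) → h * (1# + 1#) ≈ 1# → m + d ≈ 0# →
    (h * x) * (1# * x + d) ≈ 0# * x + 1#
  half-root-reciprocal {x} {m} {d} {h} root half inverse = ≈-by-certificate
    (solve 4 (λ x m d h →
         (h :* x) :* (con 1 :* x :+ d)
           :+ (h :* (m :* x :+ (con 1 :+ con 1)) :+ (con 1 :+ (h :* x) :* con 0))
      := (con 0 :* x :+ con 1)
           :+ (h :* (x :* x) :+ (h :* (con 1 :+ con 1) :+ (h :* x) :* (m :+ d))))
      refl x m d h)
    (+-cong (*-congˡ root) (+-cong half (*-congˡ inverse)))

  -- lhs − rhs = h²n·(x² − nx − 2) + ((k + 1)nhx + hn + k + 1)·(2h − 1) + (h²nx + h)·(n − 2k − 1)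
  half-root-shift : ∀ {x n k h} →
    x * x ≈ n * x + (1# + 1#) → h * (1# + 1#) ≈ 1# → n ≈ (1# + 1#) * k + 1# →
    (h * (x + 1#)) * (n * (h * x) + 1#) ≈ ((k + 1#) * n + 1#) * (h * x) + (k + 1#)
  half-root-shift {x} {n} {k} {h} root half odd = ≈-by-certificate
    (solve 4 (λ x n k h →
         (h :* (x :+ con 1)) :* (n :* (h :* x) :+ con 1)
           :+ (h :* h :* n :* (n :* x :+ (con 1 :+ con 1))
           :+ (((k :+ con 1) :* n :* h :* x :+ h :* n :+ k :+ con 1) :* con 1
           :+ (h :* h :* n :* x :+ h) :* ((con 1 :+ con 1) :* k :+ con 1)))
      := ((k :+ con 1) :* n :+ con 1) :* (h :* x) :+ (k :+ con 1)
           :+ (h :* h :* n :* (x :* x)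
           :+ (((k :+ con 1) :* n :* h :* x :+ h :* n :+ k :+ con 1) :* (h :* (con 1 :+ con 1))
           :+ (h :* h :* n :* x :+ h) :* n)))
      refl x n k h)
    (+-cong (*-congˡ root) (+-cong (*-congˡ half) (*-congˡ odd)))

open MöbiusIdentities using (half-root-reciprocal; half-root-shift)
open import Data.Nat using (_≤_; _*_; _+_)
open ≡ using (refl; sym; trans; cong; cong₂; isEquivalence)

fromℚᵘ-homo-+ : ∀ p q → fromℚᵘ (p ℚᵘ.+ q) ≡ fromℚᵘ p ℚ.+ fromℚᵘ q
fromℚᵘ-homo-+ p q = ℚP.toℚᵘ-injective (begin
  toℚᵘ (fromℚᵘ (p ℚᵘ.+ q))                  ≈⟨ ℚP.toℚᵘ-fromℚᵘ (p ℚᵘ.+ q) ⟩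
  p ℚᵘ.+ q                                   ≈⟨ ℚᵘP.+-cong (ℚP.toℚᵘ-fromℚᵘ p) (ℚP.toℚᵘ-fromℚᵘ q) ⟨
  toℚᵘ (fromℚᵘ p) ℚᵘ.+ toℚᵘ (fromℚᵘ q)     ≈⟨ ℚP.toℚᵘ-homo-+ (fromℚᵘ p) (fromℚᵘ q) ⟨
  toℚᵘ (fromℚᵘ p ℚ.+ fromℚᵘ q)              ∎)
  where open ℚᵘP.≃-Reasoning

fromℚᵘ-homo-* : ∀ p q → fromℚᵘ (p ℚᵘ.* q) ≡ fromℚᵘ p ℚ.* fromℚᵘ q
fromℚᵘ-homo-* p q = ℚP.toℚᵘ-injective (begin
  toℚᵘ (fromℚᵘ (p ℚᵘ.* q))                  ≈⟨ ℚP.toℚᵘ-fromℚᵘ (p ℚᵘ.* q) ⟩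
  p ℚᵘ.* q                                   ≈⟨ ℚᵘP.*-cong (ℚP.toℚᵘ-fromℚᵘ p) (ℚP.toℚᵘ-fromℚᵘ q) ⟨
  toℚᵘ (fromℚᵘ p) ℚᵘ.* toℚᵘ (fromℚᵘ q)     ≈⟨ ℚP.toℚᵘ-homo-* (fromℚᵘ p) (fromℚᵘ q) ⟨
  toℚᵘ (fromℚᵘ p ℚ.* fromℚᵘ q)              ∎)
  where open ℚᵘP.≃-Reasoning

-- i / 1 is fromℚᵘ (mkℚᵘ i 0) by definition.
/1-homo-+ : ∀ i j → (i ℤ.+ j) / 1 ≡ i / 1 ℚ.+ j / 1
/1-homo-+ i j = trans
  (cong (_/ 1) (cong₂ ℤ._+_ (sym (ℤP.*-identityʳ i)) (sym (ℤP.*-identityʳ j))))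
  (fromℚᵘ-homo-+ (ℚᵘ.mkℚᵘ i 0) (ℚᵘ.mkℚᵘ j 0))

/1-homo-* : ∀ i j → (i ℤ.* j) / 1 ≡ (i / 1) ℚ.* (j / 1)
/1-homo-* i j = fromℚᵘ-homo-* (ℚᵘ.mkℚᵘ i 0) (ℚᵘ.mkℚᵘ j 0)

module QuadRing {D : ℕ} where
  open AlgebraDefinitions {A = Quad D} _≡_
  open NaturalCoefficientsSolver (CommutativeRing.commutativeSemiring ℚP.+-*-commutativeRing)
    using (solve; _:=_; _:+_; _:*_; con)

  infix 8 ⊖_
  ⊖_ : Quad D → Quad D
  ⊖ (a + b √) = (ℚ.- a) + (ℚ.- b) √

  ⊕-assoc : Associative _⊕_
  ⊕-assoc (a + b √) (c + d √) (e + f √) = cong₂ _+_√ (ℚP.+-assoc a c e) (ℚP.+-assoc b d f)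

  ⊕-comm : Commutative _⊕_
  ⊕-comm (a + b √) (c + d √) = cong₂ _+_√ (ℚP.+-comm a c) (ℚP.+-comm b d)

  ⊕-identityˡ : LeftIdentity (ι 0ℚ) _⊕_
  ⊕-identityˡ (a + b √) = cong₂ _+_√ (ℚP.+-identityˡ a) (ℚP.+-identityˡ b)

  ⊖-inverseˡ : LeftInverse (ι 0ℚ) ⊖_ _⊕_
  ⊖-inverseˡ (a + b √) = cong₂ _+_√ (ℚP.+-inverseˡ a) (ℚP.+-inverseˡ b)

  ⊗-assoc : Associative _⊗_
  ⊗-assoc (a + b √) (c + d √) (e + f √) = cong₂ _+_√
    (solve 7 (λ Q a b c d e f →
         (a :* c :+ Q :* (b :* d)) :* e :+ Q :* ((a :* d :+ b :* c) :* f)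
      := a :* (c :* e :+ Q :* (d :* f)) :+ Q :* (b :* (c :* f :+ d :* e)))
      refl ((+ D) / 1) a b c d e f)
    (solve 7 (λ Q a b c d e f →
         (a :* c :+ Q :* (b :* d)) :* f :+ (a :* d :+ b :* c) :* e
      := a :* (c :* f :+ d :* e) :+ b :* (c :* e :+ Q :* (d :* f)))
      refl ((+ D) / 1) a b c d e f)

  ⊗-comm : Commutative _⊗_
  ⊗-comm (a + b √) (c + d √) = cong₂ _+_√
    (solve 5 (λ Q a b c d → a :* c :+ Q :* (b :* d) := c :* a :+ Q :* (d :* b))
      refl ((+ D) / 1) a b c d)
    (solve 4 (λ a b c d → a :* d :+ b :* c := c :* b :+ d :* a) refl a b c d)

  ⊗-identityˡ : LeftIdentity (ι 1ℚ) _⊗_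
  ⊗-identityˡ (a + b √) = cong₂ _+_√
    (solve 3 (λ Q a b → con 1 :* a :+ Q :* (con 0 :* b) := a) refl ((+ D) / 1) a b)
    (solve 2 (λ a b → con 1 :* b :+ con 0 :* a := b) refl a b)

  ⊗-distribˡ-⊕ : _⊗_ DistributesOverˡ _⊕_
  ⊗-distribˡ-⊕ (a + b √) (c + d √) (e + f √) = cong₂ _+_√
    (solve 7 (λ Q a b c d e f →
         a :* (c :+ e) :+ Q :* (b :* (d :+ f))
      := (a :* c :+ Q :* (b :* d)) :+ (a :* e :+ Q :* (b :* f)))
      refl ((+ D) / 1) a b c d e f)
    (solve 6 (λ a b c d e f →
         a :* (d :+ f) :+ b :* (c :+ e) := (a :* d :+ b :* c) :+ (a :* f :+ b :* e))
      refl a b c d e f)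

  ⊕-⊗-isCommutativeRing : IsCommutativeRing _≡_ _⊕_ _⊗_ ⊖_ (ι 0ℚ) (ι 1ℚ)
  ⊕-⊗-isCommutativeRing = record
    { isRing = record
      { +-isAbelianGroup = record
        { isGroup = record
          { isMonoid = record
            { isSemigroup = record
              { isMagma = record { isEquivalence = isEquivalence ; ∙-cong = cong₂ _⊕_ }
              ; assoc = ⊕-assoc
              }
            ; identity = Consequences.comm∧idˡ⇒id ⊕-comm ⊕-identityˡ
            }
          ; inverse = Consequences.comm∧invˡ⇒inv ⊕-comm ⊖-inverseˡ
          ; ⁻¹-cong = cong ⊖_
          }
        ; comm = ⊕-comm
        }
      ; *-cong = cong₂ _⊗_
      ; *-assoc = ⊗-assoc
      ; *-identity = Consequences.comm∧idˡ⇒id ⊗-comm ⊗-identityˡ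
      ; distrib = ⊗-distribˡ-⊕ , Consequences.comm∧distrˡ⇒distrʳ ⊗-comm ⊗-distribˡ-⊕
      }
    ; *-comm = ⊗-comm
    }

⊕-⊗-commutativeRing : ℕ → CommutativeRing 0ℓ 0ℓ
⊕-⊗-commutativeRing D = record { isCommutativeRing = QuadRing.⊕-⊗-isCommutativeRing {D} }

module _ {D : ℕ} where
  ι-homo-* : ∀ p q → ι {D} (p ℚ.* q) ≡ ι p ⊗ ι q
  ι-homo-* p q = cong₂ _+_√
    (sym (trans (cong (p ℚ.* q ℚ.+_) (ℚP.*-zeroʳ ((+ D) / 1))) (ℚP.+-identityʳ (p ℚ.* q))))
    (sym (trans (cong₂ ℚ._+_ (ℚP.*-zeroʳ p) (ℚP.*-zeroˡ q)) (ℚP.+-identityʳ 0ℚ)))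

  ιℤ-homo-+ : ∀ i j → ιℤ {D} (i ℤ.+ j) ≡ ιℤ i ⊕ ιℤ j
  ιℤ-homo-+ i j = cong ι (/1-homo-+ i j)

  ιℤ-homo-* : ∀ i j → ιℤ {D} (i ℤ.* j) ≡ ιℤ i ⊗ ιℤ j
  ιℤ-homo-* i j = trans (cong ι (/1-homo-* i j)) (ι-homo-* (i / 1) (j / 1))

  ½⊗2≡1 : ι ½ ⊗ (ι 1ℚ ⊕ ι 1ℚ) ≡ ι {D} 1ℚ
  ½⊗2≡1 = sym (ι-homo-* ½ (1ℚ ℚ.+ 1ℚ))

  ιℤ-inverseʳ : ∀ i → ιℤ {D} i ⊕ ιℤ (ℤ.- i) ≡ ι 0ℚ
  ιℤ-inverseʳ i = trans (sym (ιℤ-homo-+ i (ℤ.- i))) (cong ιℤ (ℤP.+-inverseʳ i))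

  ιℤ-odd : ∀ k → ιℤ {D} (+ (2 * k + 1)) ≡ (ι 1ℚ ⊕ ι 1ℚ) ⊗ ιℤ (+ k) ⊕ ι 1ℚ
  ιℤ-odd k = begin
    ιℤ (+ (2 * k + 1))                    ≡⟨ cong ιℤ (ℤP.pos-+ (2 * k) 1) ⟩
    ιℤ (+ (2 * k) ℤ.+ + 1)                ≡⟨ ιℤ-homo-+ (+ (2 * k)) (+ 1) ⟩
    ιℤ (+ (2 * k)) ⊕ ι 1ℚ                 ≡⟨ cong (λ t → ιℤ t ⊕ ι 1ℚ) (ℤP.pos-* 2 k) ⟩
    ιℤ (+ 2 ℤ.* + k) ⊕ ι 1ℚ               ≡⟨ cong (_⊕ ι 1ℚ) (ιℤ-homo-* (+ 2) (+ k)) ⟩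
    (ι 1ℚ ⊕ ι 1ℚ) ⊗ ιℤ (+ k) ⊕ ι 1ℚ      ∎
    where open ≡.≡-Reasoning

  ιℤ-shift : ∀ i j → ιℤ {D} ((i ℤ.+ + 1) ℤ.* j ℤ.+ + 1) ≡ (ιℤ i ⊕ ι 1ℚ) ⊗ ιℤ j ⊕ ι 1ℚ
  ιℤ-shift i j = trans (ιℤ-homo-+ ((i ℤ.+ + 1) ℤ.* j) (+ 1))
    (cong (_⊕ ι 1ℚ) (trans (ιℤ-homo-* (i ℤ.+ + 1) j) (cong (_⊗ ιℤ j) (ιℤ-homo-+ i (+ 1)))))

shift-det : ∀ i j → ((i ℤ.+ + 1) ℤ.* j ℤ.+ + 1) ℤ.* + 1 ℤ.- (i ℤ.+ + 1) ℤ.* j ≡ + 1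
shift-det = solve-∀

lemma6p5 : (m k : ℕ) → m ≡ 2 * k + 1 → 3 ≤ m →
    (α : Quad (m * m + 8)) →
    α ⊗ α ≡ ιℤ (+ m) ⊗ α ⊕ ιℤ (+ 2) →
    (α ∼ (ι (+ 1 / 2) ⊗ α)) × ((ι (+ 1 / 2) ⊗ α) ∼ (ι (+ 1 / 2) ⊗ (α ⊕ ιℤ (+ 1))))
lemma6p5 m k refl _ α root =
    ( + 0 , + 1 , + 1 , ℤ.- + m , inj₂ refl
    , half-root-reciprocal R {α} {ιℤ (+ m)} {ιℤ (ℤ.- + m)} {ι ½} root ½⊗2≡1 (ιℤ-inverseʳ (+ m)) )
  , ( (+ k ℤ.+ + 1) ℤ.* + m ℤ.+ + 1 , + k ℤ.+ + 1 , + m , + 1 , inj₁ (shift-det (+ k) (+ m))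
    , trans (half-root-shift R {α} {ιℤ (+ m)} {ιℤ (+ k)} {ι ½} root ½⊗2≡1 (ιℤ-odd k))
        (sym (cong₂ (λ a b → a ⊗ (ι ½ ⊗ α) ⊕ b) (ιℤ-shift (+ k) (+ m)) (ιℤ-homo-+ (+ k) (+ 1)))) )
  where
  R : CommutativeRing 0ℓ 0ℓ
  R = ⊕-⊗-commutativeRing (m * m + 8)
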